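{- Let $\tau$ be a partition with $L=\ell(\tau)$ nonzero parts and let $\kappa$ be an indeterminate. Define the rational functions of $\kappa$ \begin{align*} P_1(\tau)&=\prod_{i=2}^{L}\prod_{j=1}^{\tau_i}\bigl(1+\kappa(j-i)\bigr)_{i-1},\\ P_2(\tau)&=\prod_{1\le i<j\le L}\prod_{j_1=1}^{\tau_i}\prod_{j_2=1}^{\tau_j}\prod_{r=1}^{j-i}\Bigl(1-\frac{\kappa^2}{(r+\kappa(j_2-j_1-j+i))^2}\Bigr),\\ P_3(\tau)&=\prod_{1\le i<j\le L}\prod_{j_1=1}^{\tau_i}\prod_{j_2=1}^{\tau_j}\Bigl(1+\frac{\kappa}{j-i+\kappa(j_2-j_1-j+i)}\Bigr),\\ H^s(\tau)&=\prod_{(i,j)\in\tau}\bigl(1-\kappa h(i,j)\bigr)_{\mathrm{leg}(i,j)}. \end{align*} Then $\dfrac{P_1(\tau)P_2(\tau)}{P_3(\tau)}=H^s(\tau)$.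
   Context: $\tau$ is identified with its Ferrers diagram $\{(i,j):1\le i\le L,1\le j\le\tau_i\}$; $\tau'_m=\#\{i:\tau_i\ge m\}$; for $(i,j)\in\tau$, $\mathrm{arm}(i,j)=\tau_i-j$, $\mathrm{leg}(i,j)=\tau'_j-i$, $h(i,j)=\mathrm{arm}(i,j)+\mathrm{leg}(i,j)+1$. Pochhammer symbol: $(t)_n=\prod_{k=1}^n(t+k-1)$, $(t)_0=1$. -}

module Defs where

open import Data.Nat as ℕ using (ℕ; zero; suc; _∸_; _≤_; _<_; _≤?_)
open import Data.Integer as ℤ using (ℤ; +_)
open import Data.Rational using (ℚ; _/_; 0ℚ; 1ℚ; _+_; _*_; _-_; 1/_; ≢-nonZero)
open import Data.Rational.Properties using (_≟_)
open import Data.List using (List; []; _∷_; length; map; upTo; foldr; filter)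
open import Data.List.Relation.Unary.All using (All)
open import Data.List.Relation.Unary.Linked using (Linked)
open import Relation.Nullary using (yes; no)
open import Data.Product using (_×_)
open import Relation.Binary.PropositionalEquality using (_≢_)

IsPartition : List ℕ → Set
IsPartition τ = All (λ p → 1 ≤ p) τ × Linked (λ a b → b ≤ a) τ

-- τ_i, 1-based; 0 outside 1..ℓ(τ)
part : List ℕ → ℕ → ℕ
part []       _             = 0
part (p ∷ τ)  zero          = 0
part (p ∷ τ)  (suc zero)    = p
part (p ∷ τ)  (suc (suc i)) = part τ (suc i)

conj : List ℕ → ℕ → ℕ
conj τ m = length (filter (λ p → m ≤? p) τ)

arm leg hook : List ℕ → ℕ → ℕ → ℕ
arm τ i j  = part τ i ∸ j
leg τ i j  = conj τ j ∸ i
hook τ i j = suc (arm τ i j ℕ.+ leg τ i j)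

ℕq : ℕ → ℚ
ℕq n = + n / 1

ℤq : ℤ → ℚ
ℤq z = z / 1

_⊖_ : ℕ → ℕ → ℤ
m ⊖ n = + m ℤ.- + n

-- ∏_{k=a}^{b} f k  (empty product = 1 when b < a)
prod : ℕ → ℕ → (ℕ → ℚ) → ℚ
prod a b f = foldr _*_ 1ℚ (map (λ k → f (a ℕ.+ k)) (upTo (suc b ∸ a)))

poch : ℚ → ℕ → ℚ
poch t n = prod 1 n (λ k → t + ℕq (k ∸ 1))

-- total reciprocal (value at 0 irrelevant: only used under nonvanishing hypotheses)
inv : ℚ → ℚ
inv q with q ≟ 0ℚ
... | yes _  = 0ℚ
... | no q≢0 = 1/_ q {{≢-nonZero q≢0}}

shift : ℕ → ℕ → ℕ → ℕ → ℤ
shift i j j₁ j₂ = ((j₂ ⊖ j₁) ℤ.- + j) ℤ.+ + i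

P₁ : List ℕ → ℚ → ℚ
P₁ τ κ = prod 2 (length τ) λ i → prod 1 (part τ i) λ j →
  poch (1ℚ + κ * ℤq (j ⊖ i)) (i ∸ 1)

P₂ : List ℕ → ℚ → ℚ
P₂ τ κ = prod 1 (length τ) λ i → prod (suc i) (length τ) λ j →
  prod 1 (part τ i) λ j₁ → prod 1 (part τ j) λ j₂ → prod 1 (j ∸ i) λ r →
    1ℚ - (κ * κ) * inv ((ℕq r + κ * ℤq (shift i j j₁ j₂)) * (ℕq r + κ * ℤq (shift i j j₁ j₂)))

P₃ : List ℕ → ℚ → ℚ
P₃ τ κ = prod 1 (length τ) λ i → prod (suc i) (length τ) λ j →
  prod 1 (part τ i) λ j₁ → prod 1 (part τ j) λ j₂ →
    1ℚ + κ * inv (ℕq (j ∸ i) + κ * ℤq (shift i j j₁ j₂))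

Hs : List ℕ → ℚ → ℚ
Hs τ κ = prod 1 (length τ) λ i → prod 1 (part τ i) λ j →
  poch (1ℚ - κ * ℕq (hook τ i j)) (leg τ i j)

Admissible : List ℕ → ℚ → Set
Admissible τ κ = ∀ i j j₁ j₂ r → 1 ≤ i → i < j → j ≤ length τ →
  1 ≤ j₁ → j₁ ≤ part τ i → 1 ≤ j₂ → j₂ ≤ part τ j → 1 ≤ r → r ≤ j ∸ i →
  ℕq r + κ * ℤq (shift i j j₁ j₂) ≢ 0ℚ

module Submission where

-- Every factor of P₁, P₂, P₃ and Hˢ is a ratio of linear forms r + κm with r ∈ ℕ, m ∈ ℤ:
-- (1 + κm)ₙ = ∏_{r=1}^{n} (r + κm), 1 − κ²/(r + κs)² = (r + κ(s − 1))(r + κ(s + 1))/(r + κs)²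
-- and 1 + κ/(d + κs) = (d + κ(s + 1))/(d + κs). After clearing denominators it suffices that the
-- multisets of linear forms on both sides agree, which is tested by comparing their weights
-- ∑ w(r, m) for an arbitrary w. Let Φ(d, u) be the weight of (1, u − d), …, (d, u − d). The
-- contribution of rows i < j and columns j₁, j₂ to P₂/P₃ is a second difference in j₁, which
-- telescopes to boundary terms at the two ends of row i. Summed over the rows above a fixed row j,
-- the first boundary terms telescope again and cancel the weight of P₁; summed over the rows below
-- a fixed row i that still reach column j₂ (there are leg(i, j₂) of them), the second ones
-- telescope to the weight of Hˢ.

open import Defs
open import Level using (0ℓ)
open import Data.Nat as ℕ using (ℕ; zero; suc; _∸_; _≤_; _<_; z≤n; s≤s; _<?_)
import Data.Nat.Properties as ℕP
open import Data.Integer as ℤ using (ℤ; 0ℤ; 1ℤ)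
import Data.Integer.Properties as ℤP
import Data.Integer.Tactic.RingSolver as ℤSolver
open import Data.Rational using (ℚ; 0ℚ; 1ℚ; _*_)
import Data.Rational.Properties as ℚP
open import Data.Rational.Solver using (module +-*-Solver)
open import Data.List using (List; []; _∷_; _++_; length; foldr; map; applyUpTo; upTo)
import Data.List.Properties as ListP
import Data.List.Relation.Unary.All as All
import Data.List.Relation.Unary.AllPairs as AllPairs
open import Data.List.Relation.Unary.Any using (here; there)
open import Data.List.Relation.Unary.Linked as Linked using (Linked)
open import Data.List.Relation.Unary.Linked.Properties using (Linked⇒AllPairs)
open import Data.List.Membership.Propositional using (_∈_)
open import Data.List.Membership.Propositional.Properties using (∈-∃++)
open import Data.Product using (_×_; _,_; uncurry)
open import Data.Product.Properties using (≡-dec)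
open import Data.Bool using (if_then_else_)
open import Algebra.Bundles using (CommutativeMonoid)
import Algebra.Properties.CommutativeSemigroup as CommutativeSemigroupProperties
open import Relation.Nullary using (¬_; does; yes; no; contradiction)
open import Relation.Nullary.Decidable using (dec-true; dec-false)
open import Relation.Unary using (Pred; Decidable)
open import Relation.Binary.Definitions using (DecidableEquality)
open import Relation.Binary.PropositionalEquality
open import Function using (_⇔_; Equivalence; mk⇔)
import Function.Properties.Equivalence as ⇔
import Data.Nat.Coprimality as Coprimality
open CommutativeSemigroupProperties ℕP.+-commutativeSemigroup using () renaming (x∙yz≈y∙xz to +-left-swap)
open CommutativeSemigroupProperties (CommutativeMonoid.commutativeSemigroup ℚP.*-1-commutativeMonoid)
  using () renaming (x∙yz≈y∙xz to *-left-swap)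

open ≡-Reasoning

-- Finite sums of integers

module _ where
  open import Data.Integer using (_+_; _-_; -_)

  ∑ : ℕ → (ℕ → ℤ) → ℤ
  ∑ zero    f = 0ℤ
  ∑ (suc n) f = f 0 + ∑ n (λ k → f (suc k))

  syntax ∑ n (λ k → e) = ∑[ k < n ] e

  ∑-congᵇ : ∀ n {f g : ℕ → ℤ} → (∀ k → k < n → f k ≡ g k) → ∑ n f ≡ ∑ n g
  ∑-congᵇ zero    eq = refl
  ∑-congᵇ (suc n) eq = cong₂ _+_ (eq 0 (s≤s z≤n)) (∑-congᵇ n (λ k k<n → eq (suc k) (s≤s k<n)))

  ∑-cong : ∀ n {f g : ℕ → ℤ} → (∀ k → f k ≡ g k) → ∑ n f ≡ ∑ n g
  ∑-cong n eq = ∑-congᵇ n (λ k _ → eq k)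

  ∑-zero : ∀ n → ∑[ k < n ] 0ℤ ≡ 0ℤ
  ∑-zero zero    = refl
  ∑-zero (suc n) = trans (ℤP.+-identityˡ _) (∑-zero n)

  ∑-zeroᵇ : ∀ n {f : ℕ → ℤ} → (∀ k → k < n → f k ≡ 0ℤ) → ∑ n f ≡ 0ℤ
  ∑-zeroᵇ n eq = trans (∑-congᵇ n eq) (∑-zero n)

  ∑-distrib-+ : ∀ n (f g : ℕ → ℤ) → ∑[ k < n ] (f k + g k) ≡ ∑ n f + ∑ n g
  ∑-distrib-+ zero    f g = refl
  ∑-distrib-+ (suc n) f g = trans (cong ((f 0 + g 0) +_) (∑-distrib-+ n _ _)) (interchange (f 0) (g 0) _ _)
    where
    interchange : ∀ a b c d → (a + b) + (c + d) ≡ (a + c) + (b + d)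
    interchange = ℤSolver.solve-∀

  ∑-distrib-neg : ∀ n (f : ℕ → ℤ) → ∑[ k < n ] (- f k) ≡ - ∑ n f
  ∑-distrib-neg zero    f = refl
  ∑-distrib-neg (suc n) f = trans (cong ((- f 0) +_) (∑-distrib-neg n _)) (sym (ℤP.neg-distrib-+ (f 0) _))

  ∑-distrib-- : ∀ n (f g : ℕ → ℤ) → ∑[ k < n ] (f k - g k) ≡ ∑ n f - ∑ n g
  ∑-distrib-- n f g = trans (∑-distrib-+ n f _) (cong (∑ n f +_) (∑-distrib-neg n g))

  ∑-last : ∀ n (f : ℕ → ℤ) → ∑ (suc n) f ≡ ∑ n f + f n
  ∑-last zero    f = ℤP.+-comm (f 0) 0ℤ
  ∑-last (suc n) f = trans (cong (f 0 +_) (∑-last n _)) (sym (ℤP.+-assoc (f 0) _ _))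

  ∑-split : ∀ m n (f : ℕ → ℤ) → ∑ (m ℕ.+ n) f ≡ ∑ m f + ∑[ k < n ] f (m ℕ.+ k)
  ∑-split zero    n f = sym (ℤP.+-identityˡ _)
  ∑-split (suc m) n f = trans (cong (f 0 +_) (∑-split m n _)) (sym (ℤP.+-assoc (f 0) _ _))

  ∑-comm : ∀ m n (f : ℕ → ℕ → ℤ) → ∑[ i < m ] ∑[ j < n ] f i j ≡ ∑[ j < n ] ∑[ i < m ] f i j
  ∑-comm zero    n f = sym (∑-zero n)
  ∑-comm (suc m) n f = trans (cong (∑ n (f 0) +_) (∑-comm m n _)) (sym (∑-distrib-+ n (f 0) _))

  ∑-telescope : ∀ n (h : ℕ → ℤ) → ∑[ k < n ] (h (suc k) - h k) ≡ h n - h 0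
  ∑-telescope zero    h = sym (ℤP.+-inverseʳ (h 0))
  ∑-telescope (suc n) h = trans (cong ((h 1 - h 0) +_) (∑-telescope n (λ k → h (suc k)))) (chain (h 0) (h 1) (h (suc n)))
    where
    chain : ∀ a b c → (b - a) + (c - b) ≡ c - a
    chain = ℤSolver.solve-∀

  ∑-telescope-down : ∀ n (h : ℕ → ℤ) → ∑[ k < n ] (h k - h (suc k)) ≡ h 0 - h n
  ∑-telescope-down zero    h = sym (ℤP.+-inverseʳ (h 0))
  ∑-telescope-down (suc n) h = trans (cong ((h 0 - h 1) +_) (∑-telescope-down n (λ k → h (suc k))))
                                     (chain (h 0) (h 1) (h (suc n)))
    where
    chain : ∀ a b c → (a - b) + (b - c) ≡ a - c
    chain = ℤSolver.solve-∀

  ∑-drop-zero-head : ∀ n (f : ℕ → ℤ) → f 0 ≡ 0ℤ → ∑[ k < n ∸ 1 ] f (suc k) ≡ ∑ n f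
  ∑-drop-zero-head zero    f _    = refl
  ∑-drop-zero-head (suc n) f f0≡0 = sym (trans (cong (_+ ∑[ k < n ] f (suc k)) f0≡0) (ℤP.+-identityˡ _))

  ∑-reverse : ∀ n (f : ℕ → ℤ) → ∑[ k < n ] f (n ∸ suc k) ≡ ∑ n f
  ∑-reverse zero    f = refl
  ∑-reverse (suc n) f = trans (cong (f n +_) (∑-reverse n f)) (trans (ℤP.+-comm (f n) _) (sym (∑-last n f)))

  ∑-restrict : ∀ {m n} (f : ℕ → ℤ) {P : Pred ℕ 0ℓ} (P? : Decidable P) → m ≤ n →
    (∀ k → k < n → P k ⇔ k < m) →
    ∑[ k < n ] (if does (P? k) then f k else 0ℤ) ≡ ∑ m f
  ∑-restrict {m} f P? m≤n P⇔ with ℕP.m≤n⇒∃[o]m+o≡n m≤n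
  ... | r , refl = begin
    ∑ (m ℕ.+ r) g                              ≡⟨ ∑-split m r g ⟩
    ∑ m g + ∑[ k < r ] g (m ℕ.+ k)           ≡⟨ cong₂ _+_ (∑-congᵇ m inside) (∑-zeroᵇ r outside) ⟩
    ∑ m f + 0ℤ                               ≡⟨ ℤP.+-identityʳ _ ⟩
    ∑ m f                                      ∎
    where
    g : ℕ → ℤ
    g k = if does (P? k) then f k else 0ℤ
    inside : ∀ k → k < m → g k ≡ f k
    inside k k<m = cong (if_then f k else 0ℤ)
      (dec-true (P? k) (Equivalence.from (P⇔ k (ℕP.<-≤-trans k<m (ℕP.m≤m+n m r))) k<m))
    outside : ∀ k → k < r → g (m ℕ.+ k) ≡ 0ℤ
    outside k k<r = cong (if_then f (m ℕ.+ k) else 0ℤ)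
      (dec-false (P? (m ℕ.+ k)) (λ p → ℕP.m+n≮m m k (Equivalence.to (P⇔ (m ℕ.+ k) (ℕP.+-monoʳ-< m k<r)) p)))

  ∑-triangle : ∀ n (g : ℕ → ℕ → ℤ) →
    ∑[ i < n ] ∑[ e < n ∸ suc i ] g i (suc i ℕ.+ e) ≡ ∑[ j < n ] ∑[ i < j ] g i j
  ∑-triangle zero    g = refl
  ∑-triangle (suc n) g = begin
    ∑[ i < suc n ] ∑[ e < n ∸ i ] g i (suc i ℕ.+ e)
      ≡⟨ ∑-last n _ ⟩
    ∑[ i < n ] ∑[ e < n ∸ i ] g i (suc i ℕ.+ e) + ∑[ e < n ∸ n ] g n (suc n ℕ.+ e)
      ≡⟨ cong₂ _+_ (∑-congᵇ n peel-last) (cong (λ m → ∑[ e < m ] g n (suc n ℕ.+ e)) (ℕP.n∸n≡0 n)) ⟩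
    ∑[ i < n ] (∑[ e < n ∸ suc i ] g i (suc i ℕ.+ e) + g i n) + 0ℤ
      ≡⟨ trans (ℤP.+-identityʳ _) (∑-distrib-+ n _ _) ⟩
    ∑[ i < n ] ∑[ e < n ∸ suc i ] g i (suc i ℕ.+ e) + ∑[ i < n ] g i n
      ≡⟨ cong (_+ ∑[ i < n ] g i n) (∑-triangle n g) ⟩
    ∑[ j < n ] ∑[ i < j ] g i j + ∑[ i < n ] g i n
      ≡⟨ sym (∑-last n _) ⟩
    ∑[ j < suc n ] ∑[ i < j ] g i j
      ∎
    where
    peel-last : ∀ i → i < n → ∑[ e < n ∸ i ] g i (suc i ℕ.+ e) ≡ ∑[ e < n ∸ suc i ] g i (suc i ℕ.+ e) + g i n
    peel-last i i<n = begin
      ∑[ e < n ∸ i ] g i (suc i ℕ.+ e)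
        ≡⟨ cong (λ m → ∑[ e < m ] g i (suc i ℕ.+ e)) (ℕP.+-∸-assoc 1 i<n) ⟩
      ∑[ e < suc (n ∸ suc i) ] g i (suc i ℕ.+ e)
        ≡⟨ ∑-last (n ∸ suc i) _ ⟩
      ∑[ e < n ∸ suc i ] g i (suc i ℕ.+ e) + g i (suc i ℕ.+ (n ∸ suc i))
        ≡⟨ cong (λ j → ∑[ e < n ∸ suc i ] g i (suc i ℕ.+ e) + g i j) (ℕP.m+[n∸m]≡n i<n) ⟩
      ∑[ e < n ∸ suc i ] g i (suc i ℕ.+ e) + g i n
        ∎

<-∸⇔+-< : ∀ m k n → k < n ∸ m ⇔ m ℕ.+ k < n
<-∸⇔+-< m k n = mk⇔ to from
  where
  to : k < n ∸ m → m ℕ.+ k < n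
  to k<n∸m = ℕP.<-≤-trans (ℕP.+-monoʳ-< m k<n∸m)
    (ℕP.≤-reflexive (ℕP.m+[n∸m]≡n {m} (ℕP.<⇒≤ (ℕP.m∸n≢0⇒n<m (λ n∸m≡0 → contradiction (subst (k <_) n∸m≡0 k<n∸m) ℕP.n≮0)))))
  from : m ℕ.+ k < n → k < n ∸ m
  from m+k<n = subst (_< n ∸ m) (ℕP.m+n∸m≡n m k) (ℕP.∸-monoˡ-< m+k<n (ℕP.m≤m+n m k))

-- Conjugate partitions

Antitone : List ℕ → Set
Antitone = Linked (λ a b → b ≤ a)

conj-∷-≤ : ∀ {c q} τ → c ≤ q → conj (q ∷ τ) c ≡ suc (conj τ c)
conj-∷-≤ {c} τ c≤q = cong length (ListP.filter-accept (c ℕ.≤?_) c≤q)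

conj-∷-≰ : ∀ {c q} τ → ¬ c ≤ q → conj (q ∷ τ) c ≡ conj τ c
conj-∷-≰ {c} τ c≰q = cong length (ListP.filter-reject (c ℕ.≤?_) c≰q)

conj-≤-length : ∀ τ c → conj τ c ≤ length τ
conj-≤-length τ c = ListP.length-filter (c ℕ.≤?_) τ

conj-below-head : ∀ {c q τ} → Antitone (q ∷ τ) → ¬ c ≤ q → conj τ c ≡ 0
conj-below-head {c} sorted c≰q = cong length (ListP.filter-none (c ℕ.≤?_)
  (All.map (λ p≤q c≤p → c≰q (ℕP.≤-trans c≤p p≤q))
           (AllPairs.head (Linked⇒AllPairs (λ b≤a c≤b → ℕP.≤-trans c≤b b≤a) sorted))))

≤-part⇔<-conj : ∀ {τ} → Antitone τ → ∀ {k} → k < length τ → ∀ c → c ≤ part τ (suc k) ⇔ k < conj τ c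
≤-part⇔<-conj {q ∷ τ} sorted {zero} _ c with c ℕ.≤? q
... | yes c≤q = mk⇔ (λ _ → subst (0 <_) (sym (conj-∷-≤ τ c≤q)) (s≤s z≤n)) (λ _ → c≤q)
... | no  c≰q = mk⇔ (λ c≤q → contradiction c≤q c≰q)
  (λ 0<conj → contradiction (subst (0 <_) (trans (conj-∷-≰ τ c≰q) (conj-below-head sorted c≰q)) 0<conj) ℕP.n≮0)
≤-part⇔<-conj {q ∷ τ} sorted {suc k} (s≤s k<n) c with c ℕ.≤? q | ≤-part⇔<-conj (Linked.tail sorted) k<n c
... | yes c≤q | ih rewrite conj-∷-≤ τ c≤q = mk⇔ (λ c≤p → s≤s (Equivalence.to ih c≤p)) (λ { (s≤s k<) → Equivalence.from ih k< })
... | no  c≰q | ih rewrite conj-∷-≰ τ c≰q | conj-below-head sorted c≰q =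
  mk⇔ (λ c≤p → contradiction (Equivalence.to ih c≤p) ℕP.n≮0) (λ ())

part-antitone : ∀ {τ} → Antitone τ → ∀ {i j} → i ≤ j → j < length τ → part τ (suc j) ≤ part τ (suc i)
part-antitone sorted i≤j j<n = Equivalence.from (≤-part⇔<-conj sorted (ℕP.≤-<-trans i≤j j<n) _)
  (ℕP.≤-<-trans i≤j (Equivalence.to (≤-part⇔<-conj sorted j<n _) ℕP.≤-refl))

module _ where
  open import Data.Integer using (+_; -[1+_])
  open import Data.Rational using (mkℚ; _+_; _-_; -_; ≢-nonZero)

  private
    ℤq-mkℚ : ∀ z → ℤq z ≡ mkℚ z 0 (Coprimality.sym (Coprimality.1-coprimeTo ℤ.∣ z ∣))
    ℤq-mkℚ (+ n)    = ℚP.normalize-coprime (Coprimality.sym (Coprimality.1-coprimeTo n))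
    ℤq-mkℚ -[1+ n ] = cong -_ (ℚP.normalize-coprime (Coprimality.sym (Coprimality.1-coprimeTo (suc n))))

  ℤq-+ : ∀ a b → ℤq (a ℤ.+ b) ≡ ℤq a + ℤq b
  ℤq-+ a b rewrite ℤq-mkℚ a | ℤq-mkℚ b =
    cong ℤq (sym (cong₂ ℤ._+_ (ℤP.*-identityʳ a) (ℤP.*-identityʳ b)))

  ℤq-neg : ∀ a → ℤq (ℤ.- a) ≡ - ℤq a
  ℤq-neg (+ zero)  = refl
  ℤq-neg (+ suc n) = refl
  ℤq-neg -[1+ n ]  rewrite ℤq-mkℚ (+ suc n) = refl

  *-inv : ∀ {x} → x ≢ 0ℚ → x * inv x ≡ 1ℚ
  *-inv {x} x≢0 with x ℚP.≟ 0ℚ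
  ... | yes x≡0 = contradiction x≡0 x≢0
  ... | no  _   = ℚP.*-inverseʳ x {{≢-nonZero x≢0}}

  *-cancelʳ-≢0 : ∀ {x y z} → z ≢ 0ℚ → x * z ≡ y * z → x ≡ y
  *-cancelʳ-≢0 {x} {y} {z} z≢0 eq = begin
    x                  ≡⟨ sym (ℚP.*-identityʳ x) ⟩
    x * 1ℚ             ≡⟨ cong (x *_) (sym (*-inv z≢0)) ⟩
    x * (z * inv z)    ≡⟨ sym (ℚP.*-assoc x z (inv z)) ⟩
    (x * z) * inv z    ≡⟨ cong (_* inv z) eq ⟩
    (y * z) * inv z    ≡⟨ ℚP.*-assoc y z (inv z) ⟩
    y * (z * inv z)    ≡⟨ cong (y *_) (*-inv z≢0) ⟩
    y * 1ℚ             ≡⟨ ℚP.*-identityʳ y ⟩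
    y                  ∎

  *-≢0 : ∀ {x y} → x ≢ 0ℚ → y ≢ 0ℚ → x * y ≢ 0ℚ
  *-≢0 {x} {y} x≢0 y≢0 xy≡0 = y≢0 (*-cancelʳ-≢0 x≢0 (begin
    y * x   ≡⟨ ℚP.*-comm y x ⟩
    x * y   ≡⟨ xy≡0 ⟩
    0ℚ      ≡⟨ sym (ℚP.*-zeroˡ x) ⟩
    0ℚ * x  ∎))

-- Products of linear forms

Factor : Set
Factor = ℕ × ℤ

concatUpTo : ∀ {A : Set} → ℕ → (ℕ → List A) → List A
concatUpTo zero    xs = []
concatUpTo (suc n) xs = xs 0 ++ concatUpTo n (λ k → xs (suc k))

concatRange : ∀ {A : Set} → ℕ → ℕ → (ℕ → List A) → List A
concatRange a b xs = concatUpTo (suc b ∸ a) (λ k → xs (a ℕ.+ k))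

module _ where
  open import Data.Integer using (+_)
  open import Data.Rational using (_+_; _-_; -_)
  open +-*-Solver using (solve; _:+_; _:*_; _:-_; _:=_; con)

  linear : ℚ → Factor → ℚ
  linear κ (n , m) = ℕq n + κ * ℤq m

  ∏-linear : ℚ → List Factor → ℚ
  ∏-linear κ []       = 1ℚ
  ∏-linear κ (x ∷ xs) = linear κ x * ∏-linear κ xs

  ∏-linear-++ : ∀ κ xs ys → ∏-linear κ (xs ++ ys) ≡ ∏-linear κ xs * ∏-linear κ ys
  ∏-linear-++ κ []       ys = sym (ℚP.*-identityˡ _)
  ∏-linear-++ κ (x ∷ xs) ys = trans (cong (linear κ x *_) (∏-linear-++ κ xs ys)) (sym (ℚP.*-assoc (linear κ x) _ _))

  -- A record, so that num and den can be inferred through the nested products below.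
  record IsRatio (κ q : ℚ) (num den : List Factor) : Set where
    constructor _,_
    field
      cross-multiplied : q * ∏-linear κ den ≡ ∏-linear κ num
      denominator≢0    : ∏-linear κ den ≢ 0ℚ

  IsRatio-* : ∀ {κ q q′ num num′ den den′} → IsRatio κ q num den → IsRatio κ q′ num′ den′ →
    IsRatio κ (q * q′) (num ++ num′) (den ++ den′)
  IsRatio-* {κ} {q} {q′} {num} {num′} {den} {den′} (eq , den≢0) (eq′ , den′≢0) =
    (begin
      q * q′ * ∏-linear κ (den ++ den′)                ≡⟨ cong (q * q′ *_) (∏-linear-++ κ den den′) ⟩
      q * q′ * (∏-linear κ den * ∏-linear κ den′)      ≡⟨ solve 4 (λ a b c d → (a :* b) :* (c :* d) := (a :* c) :* (b :* d))
                                                              refl q q′ (∏-linear κ den) (∏-linear κ den′) ⟩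
      (q * ∏-linear κ den) * (q′ * ∏-linear κ den′)    ≡⟨ cong₂ _*_ eq eq′ ⟩
      ∏-linear κ num * ∏-linear κ num′                 ≡⟨ sym (∏-linear-++ κ num num′) ⟩
      ∏-linear κ (num ++ num′)                          ∎)
    , λ den++den′≡0 → *-≢0 den≢0 den′≢0 (trans (sym (∏-linear-++ κ den den′)) den++den′≡0)

  ∏-upTo-∏-linear : ∀ {κ} n {f : ℕ → ℚ} {xs : ℕ → List Factor} →
    (∀ k → k < n → f k ≡ ∏-linear κ (xs k)) → foldr _*_ 1ℚ (map f (upTo n)) ≡ ∏-linear κ (concatUpTo n xs)
  ∏-upTo-∏-linear {κ} n {f} {xs} = go n (λ k → k)
    where
    go : ∀ n (g : ℕ → ℕ) → (∀ k → k < n → f (g k) ≡ ∏-linear κ (xs (g k))) →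
      foldr _*_ 1ℚ (map f (applyUpTo g n)) ≡ ∏-linear κ (concatUpTo n (λ k → xs (g k)))
    go zero    g eq = refl
    go (suc n) g eq = trans (cong₂ _*_ (eq 0 (s≤s z≤n)) (go n (λ k → g (suc k)) (λ k k< → eq (suc k) (s≤s k<))))
                            (sym (∏-linear-++ κ (xs (g 0)) _))

  ∏-upTo-IsRatio : ∀ {κ} n {f : ℕ → ℚ} {num den : ℕ → List Factor} →
    (∀ k → k < n → IsRatio κ (f k) (num k) (den k)) →
    IsRatio κ (foldr _*_ 1ℚ (map f (upTo n))) (concatUpTo n num) (concatUpTo n den)
  ∏-upTo-IsRatio {κ} n {f} {num} {den} = go n (λ k → k)
    where
    go : ∀ n (g : ℕ → ℕ) → (∀ k → k < n → IsRatio κ (f (g k)) (num (g k)) (den (g k))) →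
      IsRatio κ (foldr _*_ 1ℚ (map f (applyUpTo g n))) (concatUpTo n (λ k → num (g k))) (concatUpTo n (λ k → den (g k)))
    go zero    g ratio = ℚP.*-identityʳ 1ℚ , ℚP.1≢0
    go (suc n) g ratio = IsRatio-* (ratio 0 (s≤s z≤n)) (go n (λ k → g (suc k)) (λ k k< → ratio (suc k) (s≤s k<)))

  pochFactors : ℕ → ℤ → List Factor
  pochFactors n m = concatRange 1 n (λ k → (k , m) ∷ [])

  ℕq-suc : ∀ n → ℕq (suc n) ≡ 1ℚ + ℕq n
  ℕq-suc n = ℤq-+ 1ℤ (+ n)

  poch-∏-linear : ∀ κ m n → poch (1ℚ + κ * ℤq m) n ≡ ∏-linear κ (pochFactors n m)
  poch-∏-linear κ m n = ∏-upTo-∏-linear n λ k _ → begin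
    (1ℚ + κ * ℤq m) + ℕq k          ≡⟨ solve 3 (λ z x n → (con 1ℚ :+ z :* x) :+ n := ((con 1ℚ :+ n) :+ z :* x) :* con 1ℚ)
                                          refl κ (ℤq m) (ℕq k) ⟩
    ((1ℚ + ℕq k) + κ * ℤq m) * 1ℚ    ≡⟨ cong (λ t → (t + κ * ℤq m) * 1ℚ) (sym (ℕq-suc k)) ⟩
    (ℕq (suc k) + κ * ℤq m) * 1ℚ     ∎

  poch-hook-∏-linear : ∀ κ h n → poch (1ℚ - κ * ℕq h) n ≡ ∏-linear κ (pochFactors n (ℤ.- + h))
  poch-hook-∏-linear κ h n = trans (cong (λ t → poch t n) (begin
    1ℚ - κ * ℕq h          ≡⟨ cong (_+_ 1ℚ) (ℚP.neg-distribʳ-* κ (ℕq h)) ⟩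
    1ℚ + κ * - ℕq h        ≡⟨ cong (λ t → 1ℚ + κ * t) (sym (ℤq-neg (+ h))) ⟩
    1ℚ + κ * ℤq (ℤ.- + h)  ∎)) (poch-∏-linear κ (ℤ.- + h) n)

  P₂-factor-IsRatio : ∀ κ r s → linear κ (r , s) ≢ 0ℚ →
    IsRatio κ (1ℚ - (κ * κ) * inv ((ℕq r + κ * ℤq s) * (ℕq r + κ * ℤq s)))
            ((r , s ℤ.- 1ℤ) ∷ (r , s ℤ.+ 1ℤ) ∷ []) ((r , s) ∷ (r , s) ∷ [])
  P₂-factor-IsRatio κ r s D≢0 = cross , *-≢0 D≢0 (*-≢0 D≢0 ℚP.1≢0)
    where
    D = ℕq r + κ * ℤq s
    cross : (1ℚ - (κ * κ) * inv (D * D)) * (D * (D * 1ℚ)) ≡ (ℕq r + κ * ℤq (s ℤ.- 1ℤ)) * ((ℕq r + κ * ℤq (s ℤ.+ 1ℤ)) * 1ℚ)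
    cross = begin
      (1ℚ - (κ * κ) * inv (D * D)) * (D * (D * 1ℚ))
        ≡⟨ solve 3 (λ d z u → (con 1ℚ :- (z :* z) :* u) :* (d :* (d :* con 1ℚ)) := d :* d :- (z :* z) :* ((d :* d) :* u))
             refl D κ (inv (D * D)) ⟩
      D * D - (κ * κ) * ((D * D) * inv (D * D))
        ≡⟨ cong (λ t → D * D - (κ * κ) * t) (*-inv (*-≢0 D≢0 D≢0)) ⟩
      D * D - (κ * κ) * 1ℚ
        ≡⟨ solve 3 (λ n z x → (n :+ z :* x) :* (n :+ z :* x) :- (z :* z) :* con 1ℚ
                             := (n :+ z :* (x :+ con (- 1ℚ))) :* ((n :+ z :* (x :+ con 1ℚ)) :* con 1ℚ))
             refl (ℕq r) κ (ℤq s) ⟩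
      (ℕq r + κ * (ℤq s + - 1ℚ)) * ((ℕq r + κ * (ℤq s + 1ℚ)) * 1ℚ)
        ≡⟨ sym (cong₂ (λ a b → (ℕq r + κ * a) * ((ℕq r + κ * b) * 1ℚ)) (ℤq-+ s (ℤ.- 1ℤ)) (ℤq-+ s 1ℤ)) ⟩
      (ℕq r + κ * ℤq (s ℤ.- 1ℤ)) * ((ℕq r + κ * ℤq (s ℤ.+ 1ℤ)) * 1ℚ)
        ∎

  P₃-factor-IsRatio : ∀ κ n s → linear κ (n , s) ≢ 0ℚ →
    IsRatio κ (1ℚ + κ * inv (ℕq n + κ * ℤq s)) ((n , s ℤ.+ 1ℤ) ∷ []) ((n , s) ∷ [])
  P₃-factor-IsRatio κ n s D≢0 = cross , *-≢0 D≢0 ℚP.1≢0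
    where
    D = ℕq n + κ * ℤq s
    cross : (1ℚ + κ * inv D) * (D * 1ℚ) ≡ (ℕq n + κ * ℤq (s ℤ.+ 1ℤ)) * 1ℚ
    cross = begin
      (1ℚ + κ * inv D) * (D * 1ℚ)      ≡⟨ solve 3 (λ d z u → (con 1ℚ :+ z :* u) :* (d :* con 1ℚ) := d :+ z :* (d :* u))
                                             refl D κ (inv D) ⟩
      D + κ * (D * inv D)              ≡⟨ cong (λ t → D + κ * t) (*-inv D≢0) ⟩
      D + κ * 1ℚ                       ≡⟨ solve 3 (λ n z x → (n :+ z :* x) :+ z :* con 1ℚ := (n :+ z :* (x :+ con 1ℚ)) :* con 1ℚ)
                                             refl (ℕq n) κ (ℤq s) ⟩
      (ℕq n + κ * (ℤq s + 1ℚ)) * 1ℚ    ≡⟨ cong (λ t → (ℕq n + κ * t) * 1ℚ) (sym (ℤq-+ s 1ℤ)) ⟩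
      (ℕq n + κ * ℤq (s ℤ.+ 1ℤ)) * 1ℚ  ∎

_≟ᶠ_ : DecidableEquality Factor
_≟ᶠ_ = ≡-dec ℕ._≟_ ℤ._≟_

multiplicity : Factor → List Factor → ℕ
multiplicity x []       = 0
multiplicity x (y ∷ ys) with x ≟ᶠ y
... | yes _ = suc (multiplicity x ys)
... | no  _ = multiplicity x ys

multiplicity-self : ∀ x xs → multiplicity x (x ∷ xs) ≡ suc (multiplicity x xs)
multiplicity-self x xs with x ≟ᶠ x
... | yes _   = refl
... | no  x≢x = contradiction refl x≢x

multiplicity-∷-injective : ∀ z x xs ys → multiplicity z (x ∷ xs) ≡ multiplicity z (x ∷ ys) →
  multiplicity z xs ≡ multiplicity z ys
multiplicity-∷-injective z x xs ys eq with z ≟ᶠ x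
... | yes _ = ℕP.suc-injective eq
... | no  _ = eq

multiplicity-++ : ∀ z xs ys → multiplicity z (xs ++ ys) ≡ multiplicity z xs ℕ.+ multiplicity z ys
multiplicity-++ z []       ys = refl
multiplicity-++ z (x ∷ xs) ys with z ≟ᶠ x
... | yes _ = cong suc (multiplicity-++ z xs ys)
... | no  _ = multiplicity-++ z xs ys

multiplicity-middle : ∀ z xs y ys → multiplicity z (xs ++ y ∷ ys) ≡ multiplicity z (y ∷ xs ++ ys)
multiplicity-middle z xs y ys = begin
  multiplicity z (xs ++ y ∷ ys)                             ≡⟨ multiplicity-++ z xs (y ∷ ys) ⟩
  multiplicity z xs ℕ.+ multiplicity z (y ∷ [] ++ ys)       ≡⟨ cong (multiplicity z xs ℕ.+_) (multiplicity-++ z (y ∷ []) ys) ⟩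
  multiplicity z xs ℕ.+ (multiplicity z (y ∷ []) ℕ.+ multiplicity z ys)
    ≡⟨ +-left-swap (multiplicity z xs) (multiplicity z (y ∷ [])) _ ⟩
  multiplicity z (y ∷ []) ℕ.+ (multiplicity z xs ℕ.+ multiplicity z ys)
    ≡⟨ cong₂ ℕ._+_ refl (sym (multiplicity-++ z xs ys)) ⟩
  multiplicity z (y ∷ []) ℕ.+ multiplicity z (xs ++ ys)     ≡⟨ sym (multiplicity-++ z (y ∷ []) (xs ++ ys)) ⟩
  multiplicity z (y ∷ xs ++ ys)                             ∎

0<multiplicity⇒∈ : ∀ x ys → 0 < multiplicity x ys → x ∈ ys
0<multiplicity⇒∈ x (y ∷ ys) 0<m with x ≟ᶠ y
... | yes x≡y = here x≡y
... | no  _   = there (0<multiplicity⇒∈ x ys 0<m)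

∏-linear-middle : ∀ κ xs y ys → ∏-linear κ (xs ++ y ∷ ys) ≡ linear κ y * ∏-linear κ (xs ++ ys)
∏-linear-middle κ []       y ys = refl
∏-linear-middle κ (x ∷ xs) y ys = begin
  linear κ x * ∏-linear κ (xs ++ y ∷ ys)                ≡⟨ cong (linear κ x *_) (∏-linear-middle κ xs y ys) ⟩
  linear κ x * (linear κ y * ∏-linear κ (xs ++ ys))     ≡⟨ *-left-swap (linear κ x) (linear κ y) _ ⟩
  linear κ y * (linear κ x * ∏-linear κ (xs ++ ys))     ∎

multiplicity⇒∏-linear-≡ : ∀ κ xs ys → (∀ z → multiplicity z xs ≡ multiplicity z ys) → ∏-linear κ xs ≡ ∏-linear κ ys
multiplicity⇒∏-linear-≡ κ []       []       _  = refl
multiplicity⇒∏-linear-≡ κ []       (y ∷ ys) eq = contradiction (trans (eq y) (multiplicity-self y ys)) (λ ())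
multiplicity⇒∏-linear-≡ κ (x ∷ xs) ys       eq
  with hs , ts , refl ← ∈-∃++ (0<multiplicity⇒∈ x ys (subst (0 <_) (trans (sym (multiplicity-self x xs)) (eq x)) (s≤s z≤n)))
  = begin
    linear κ x * ∏-linear κ xs          ≡⟨ cong (linear κ x *_) (multiplicity⇒∏-linear-≡ κ xs (hs ++ ts) rest) ⟩
    linear κ x * ∏-linear κ (hs ++ ts)  ≡⟨ sym (∏-linear-middle κ hs x ts) ⟩
    ∏-linear κ (hs ++ x ∷ ts)           ∎
  where
  rest : ∀ z → multiplicity z xs ≡ multiplicity z (hs ++ ts)
  rest z = multiplicity-∷-injective z x xs (hs ++ ts) (trans (eq z) (multiplicity-middle z hs x ts))

module _ where
  open import Data.Integer using (+_; -_; _+_; _-_)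

  overPairs : List ℕ → (ℕ → ℕ → ℕ → ℕ → List Factor) → List Factor
  overPairs τ xs =
    concatRange 1 (length τ) λ i → concatRange (suc i) (length τ) λ j →
    concatRange 1 (part τ i) λ j₁ → concatRange 1 (part τ j) λ j₂ → xs i j j₁ j₂

  P₂-block-numerator P₂-block-denominator P₃-block-numerator P₃-block-denominator : ℕ → ℤ → List Factor
  P₂-block-numerator   d s = concatRange 1 d λ r → (r , s - 1ℤ) ∷ (r , s + 1ℤ) ∷ []
  P₂-block-denominator d s = concatRange 1 d λ r → (r , s) ∷ (r , s) ∷ []
  P₃-block-numerator   d s = (d , s + 1ℤ) ∷ []
  P₃-block-denominator d s = (d , s) ∷ []

  atPair : (ℕ → ℤ → List Factor) → ℕ → ℕ → ℕ → ℕ → List Factor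
  atPair block i j j₁ j₂ = block (j ∸ i) (shift i j j₁ j₂)

  P₁-factors Hs-factors P₂-numerator P₂-denominator P₃-numerator P₃-denominator : List ℕ → List Factor
  P₁-factors τ = concatRange 2 (length τ) λ i → concatRange 1 (part τ i) λ j → pochFactors (i ∸ 1) (j ⊖ i)
  Hs-factors τ = concatRange 1 (length τ) λ i → concatRange 1 (part τ i) λ j → pochFactors (leg τ i j) (- + hook τ i j)
  P₂-numerator   τ = overPairs τ (atPair P₂-block-numerator)
  P₂-denominator τ = overPairs τ (atPair P₂-block-denominator)
  P₃-numerator   τ = overPairs τ (atPair P₃-block-numerator)
  P₃-denominator τ = overPairs τ (atPair P₃-block-denominator)

  cleared-lhs cleared-rhs : List ℕ → List Factor
  cleared-lhs τ = P₁-factors τ ++ (P₂-numerator τ ++ P₃-denominator τ)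
  cleared-rhs τ = Hs-factors τ ++ (P₂-denominator τ ++ P₃-numerator τ)

module _ (τ : List ℕ) (κ : ℚ) where

  private
    L = length τ
    pair-in-range : ∀ i e → e < L ∸ suc i → suc i ℕ.+ e < L
    pair-in-range i e = Equivalence.to (<-∸⇔+-< (suc i) e L)

  P₁-∏-linear : P₁ τ κ ≡ ∏-linear κ (P₁-factors τ)
  P₁-∏-linear = ∏-upTo-∏-linear (L ∸ 1) λ i _ → ∏-upTo-∏-linear (part τ (2 ℕ.+ i)) λ j _ →
    poch-∏-linear κ (suc j ⊖ (2 ℕ.+ i)) (suc i)

  Hs-∏-linear : Hs τ κ ≡ ∏-linear κ (Hs-factors τ)
  Hs-∏-linear = ∏-upTo-∏-linear L λ i _ → ∏-upTo-∏-linear (part τ (suc i)) λ j _ →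
    poch-hook-∏-linear κ (hook τ (suc i) (suc j)) (leg τ (suc i) (suc j))

  module _ (adm : Admissible τ κ) where

    P₂-IsRatio : IsRatio κ (P₂ τ κ) (P₂-numerator τ) (P₂-denominator τ)
    P₂-IsRatio =
      ∏-upTo-IsRatio L λ i _ → ∏-upTo-IsRatio (L ∸ suc i) λ e e< →
      ∏-upTo-IsRatio (part τ (suc i)) λ a a< → ∏-upTo-IsRatio (part τ (suc (suc i) ℕ.+ e)) λ b b< →
      ∏-upTo-IsRatio (suc (suc i) ℕ.+ e ∸ suc i) λ r r< →
      P₂-factor-IsRatio κ (suc r) _ (adm _ _ _ _ _ (s≤s z≤n) (ℕP.m≤m+n (suc (suc i)) e) (pair-in-range i e e<)
                                      (s≤s z≤n) a< (s≤s z≤n) b< (s≤s z≤n) r<)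

    P₃-IsRatio : IsRatio κ (P₃ τ κ) (P₃-numerator τ) (P₃-denominator τ)
    P₃-IsRatio =
      ∏-upTo-IsRatio L λ i _ → ∏-upTo-IsRatio (L ∸ suc i) λ e e< →
      ∏-upTo-IsRatio (part τ (suc i)) λ a a< → ∏-upTo-IsRatio (part τ (suc (suc i) ℕ.+ e)) λ b b< →
      P₃-factor-IsRatio κ (suc (suc i) ℕ.+ e ∸ suc i) _
        (adm _ _ _ _ _ (s≤s z≤n) (ℕP.m≤m+n (suc (suc i)) e) (pair-in-range i e e<)
             (s≤s z≤n) a< (s≤s z≤n) b< (ℕP.m<n⇒0<n∸m (ℕP.m≤m+n (suc (suc i)) e)) ℕP.≤-refl)

module _ where
  open import Data.Integer using (+_; _+_)

  weight : (Factor → ℤ) → List Factor → ℤ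
  weight w []       = 0ℤ
  weight w (x ∷ xs) = w x + weight w xs

  weight-++ : ∀ w xs ys → weight w (xs ++ ys) ≡ weight w xs + weight w ys
  weight-++ w []       ys = sym (ℤP.+-identityˡ _)
  weight-++ w (x ∷ xs) ys = trans (cong (_+_ (w x)) (weight-++ w xs ys)) (sym (ℤP.+-assoc (w x) _ _))

  weight-concatUpTo : ∀ w n xs → weight w (concatUpTo n xs) ≡ ∑[ k < n ] weight w (xs k)
  weight-concatUpTo w zero    xs = refl
  weight-concatUpTo w (suc n) xs =
    trans (weight-++ w (xs 0) _) (cong (_+_ (weight w (xs 0))) (weight-concatUpTo w n (λ k → xs (suc k))))

  indicator : Factor → Factor → ℤ
  indicator x y with x ≟ᶠ y
  ... | yes _ = 1ℤ
  ... | no  _ = 0ℤ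

  weight-indicator : ∀ x xs → weight (indicator x) xs ≡ + multiplicity x xs
  weight-indicator x []       = refl
  weight-indicator x (y ∷ ys) with x ≟ᶠ y
  ... | yes _ = cong (_+_ 1ℤ) (weight-indicator x ys)
  ... | no  _ = trans (ℤP.+-identityˡ _) (weight-indicator x ys)

-- The weight identity

module _ (τ : List ℕ) (w : Factor → ℤ) where
  open import Data.Integer using (+_; _+_; _-_; -_)

  private
    L = length τ
    row : ℕ → ℕ
    row i = part τ (suc i)
    gap : ∀ i e → suc i ℕ.+ e ∸ i ≡ suc e
    gap i e = trans (cong (_∸ i) (sym (ℕP.+-suc i e))) (ℕP.m+n∸m≡n i (suc e))
    pair-in-range : ∀ i e → e < L ∸ suc i → suc i ℕ.+ e < L
    pair-in-range i e = Equivalence.to (<-∸⇔+-< (suc i) e L)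

  runWeight : ℕ → ℤ → ℤ
  runWeight d y = ∑[ r < d ] w (suc r , y)

  Φ : ℕ → ℤ → ℤ
  Φ d u = runWeight d (u - + d)

  weight-pochFactors : ∀ d y → weight w (pochFactors d y) ≡ runWeight d y
  weight-pochFactors d y = trans (weight-concatUpTo w d _) (∑-cong d (λ r → ℤP.+-identityʳ _))

  weight-P₁-factors : weight w (P₁-factors τ) ≡ ∑[ j < L ] ∑[ b < row j ] Φ j (+ b)
  weight-P₁-factors = begin
    weight w (P₁-factors τ)
      ≡⟨ weight-concatUpTo w (L ∸ 1) _ ⟩
    ∑[ i < L ∸ 1 ] weight w (concatRange 1 (row (suc i)) λ j → pochFactors (suc i) (j ⊖ (2 ℕ.+ i)))
      ≡⟨ ∑-cong (L ∸ 1) (λ i → trans (weight-concatUpTo w (row (suc i)) _) (∑-cong (row (suc i)) (λ b →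
           trans (weight-pochFactors (suc i) _) (cong (runWeight (suc i)) (arith (+ b) (+ i)))))) ⟩
    ∑[ i < L ∸ 1 ] ∑[ b < row (suc i) ] Φ (suc i) (+ b)
      ≡⟨ ∑-drop-zero-head L (λ j → ∑[ b < row j ] Φ j (+ b)) (∑-zero (row 0)) ⟩
    ∑[ j < L ] ∑[ b < row j ] Φ j (+ b)
      ∎
    where
    arith : ∀ b i → (1ℤ + b) - ((1ℤ + 1ℤ) + i) ≡ b - (1ℤ + i)
    arith = ℤSolver.solve-∀

  weight-Hs-factors : weight w (Hs-factors τ) ≡ ∑[ i < L ] ∑[ b < row i ] Φ (leg τ (suc i) (suc b)) (+ b - + row i)
  weight-Hs-factors = trans (weight-concatUpTo w L _) (∑-cong L λ i →
    trans (weight-concatUpTo w (row i) _) (∑-congᵇ (row i) λ b b< →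
      trans (weight-pochFactors (leg τ (suc i) (suc b)) _) (cong (runWeight (leg τ (suc i) (suc b))) (neg-hook (leg τ (suc i) (suc b)) b<))))
    where
    neg-hook : ∀ {b P} l → b < P → - + suc ((P ∸ suc b) ℕ.+ l) ≡ (+ b - + P) - + l
    neg-hook {b} l b<P with k , refl ← ℕP.m≤n⇒∃[o]m+o≡n b<P rewrite ℕP.m+n∸m≡n (suc b) k = arith (+ b) (+ k) (+ l)
      where
      arith : ∀ b k l → - (1ℤ + (k + l)) ≡ (b - ((1ℤ + b) + k)) - l
      arith = ℤSolver.solve-∀

  -- The paper's i < j, j₁, j₂ are suc i, suc (suc i) + e, suc a, suc b.
  pairSum : (ℕ → ℕ → ℕ → ℕ → ℤ) → ℤ
  pairSum g = ∑[ i < L ] ∑[ e < L ∸ suc i ] ∑[ a < row i ] ∑[ b < row (suc i ℕ.+ e) ] g i e a b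

  pairSum-cong : ∀ {f g} → (∀ i e a b → f i e a b ≡ g i e a b) → pairSum f ≡ pairSum g
  pairSum-cong eq = ∑-cong L λ i → ∑-cong (L ∸ suc i) λ e → ∑-cong (row i) λ a → ∑-cong (row (suc i ℕ.+ e)) λ b → eq i e a b

  pairSum-distrib-+ : ∀ f g → pairSum (λ i e a b → f i e a b + g i e a b) ≡ pairSum f + pairSum g
  pairSum-distrib-+ f g =
    trans (∑-cong L λ i → trans (∑-cong (L ∸ suc i) λ e → trans (∑-cong (row i) λ a →
      ∑-distrib-+ (row (suc i ℕ.+ e)) _ _) (∑-distrib-+ (row i) _ _)) (∑-distrib-+ (L ∸ suc i) _ _)) (∑-distrib-+ L _ _)

  pairSum-distrib-- : ∀ f g → pairSum (λ i e a b → f i e a b - g i e a b) ≡ pairSum f - pairSum g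
  pairSum-distrib-- f g =
    trans (∑-cong L λ i → trans (∑-cong (L ∸ suc i) λ e → trans (∑-cong (row i) λ a →
      ∑-distrib-- (row (suc i ℕ.+ e)) _ _) (∑-distrib-- (row i) _ _)) (∑-distrib-- (L ∸ suc i) _ _)) (∑-distrib-- L _ _)

  weight-overPairs : ∀ xs → weight w (overPairs τ xs) ≡
    pairSum (λ i e a b → weight w (xs (suc i) (suc (suc i) ℕ.+ e) (suc a) (suc b)))
  weight-overPairs xs =
    trans (weight-concatUpTo w L _) (∑-cong L λ i →
    trans (weight-concatUpTo w (L ∸ suc i) _) (∑-cong (L ∸ suc i) λ e →
    trans (weight-concatUpTo w (row i) _) (∑-cong (row i) λ a →
    weight-concatUpTo w (row (suc i ℕ.+ e)) _)))

  secondDifference : ℕ → ℤ → ℤ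
  secondDifference d s =
    ((runWeight d (s - 1ℤ) + runWeight d (s + 1ℤ)) - (runWeight d s + runWeight d s)) + (w (d , s) - w (d , s + 1ℤ))

  weight-P₂-block-numerator : ∀ d s → weight w (P₂-block-numerator d s) ≡ runWeight d (s - 1ℤ) + runWeight d (s + 1ℤ)
  weight-P₂-block-numerator d s = begin
    weight w (P₂-block-numerator d s)                           ≡⟨ weight-concatUpTo w d _ ⟩
    ∑[ r < d ] (w (suc r , s - 1ℤ) + (w (suc r , s + 1ℤ) + 0ℤ)) ≡⟨ ∑-cong d (λ r → cong (_+_ (w (suc r , s - 1ℤ))) (ℤP.+-identityʳ _)) ⟩
    ∑[ r < d ] (w (suc r , s - 1ℤ) + w (suc r , s + 1ℤ))        ≡⟨ ∑-distrib-+ d _ _ ⟩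
    runWeight d (s - 1ℤ) + runWeight d (s + 1ℤ)                  ∎

  weight-P₂-block-denominator : ∀ d s → weight w (P₂-block-denominator d s) ≡ runWeight d s + runWeight d s
  weight-P₂-block-denominator d s = begin
    weight w (P₂-block-denominator d s)             ≡⟨ weight-concatUpTo w d _ ⟩
    ∑[ r < d ] (w (suc r , s) + (w (suc r , s) + 0ℤ)) ≡⟨ ∑-cong d (λ r → cong (_+_ (w (suc r , s))) (ℤP.+-identityʳ _)) ⟩
    ∑[ r < d ] (w (suc r , s) + w (suc r , s))        ≡⟨ ∑-distrib-+ d _ _ ⟩
    runWeight d s + runWeight d s                     ∎

  weight-P₂-P₃ :
    (weight w (P₂-numerator τ) - weight w (P₂-denominator τ)) + (weight w (P₃-denominator τ) - weight w (P₃-numerator τ))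
      ≡ pairSum (λ i e a b → secondDifference (suc e) ((+ b - + a) - + suc e))
  weight-P₂-P₃ = begin
    (weight w (P₂-numerator τ) - weight w (P₂-denominator τ)) + (weight w (P₃-denominator τ) - weight w (P₃-numerator τ))
      ≡⟨ cong₂ _+_ (cong₂ _-_ (weight-overPairs (atPair P₂-block-numerator)) (weight-overPairs (atPair P₂-block-denominator)))
                   (cong₂ _-_ (weight-overPairs (atPair P₃-block-denominator)) (weight-overPairs (atPair P₃-block-numerator))) ⟩
    (pairSum (blockWeight P₂-block-numerator) - pairSum (blockWeight P₂-block-denominator))
      + (pairSum (blockWeight P₃-block-denominator) - pairSum (blockWeight P₃-block-numerator))
      ≡⟨ sym (trans (pairSum-distrib-+ _ _) (cong₂ _+_ (pairSum-distrib-- _ _) (pairSum-distrib-- _ _))) ⟩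
    pairSum (λ i e a b → blockDifference (suc (suc i) ℕ.+ e ∸ suc i) (shift (suc i) (suc (suc i) ℕ.+ e) (suc a) (suc b)))
      ≡⟨ pairSum-cong (λ i e a b → trans (blockDifference≡secondDifference
                                            (suc (suc i) ℕ.+ e ∸ suc i) (shift (suc i) (suc (suc i) ℕ.+ e) (suc a) (suc b)))
           (cong₂ secondDifference (gap i e) (shift-on-pair (+ b) (+ a) (+ i) (+ e)))) ⟩
    pairSum (λ i e a b → secondDifference (suc e) ((+ b - + a) - + suc e))
      ∎
    where
    blockWeight : (ℕ → ℤ → List Factor) → ℕ → ℕ → ℕ → ℕ → ℤ
    blockWeight block i e a b = weight w (atPair block (suc i) (suc (suc i) ℕ.+ e) (suc a) (suc b))
    blockDifference : ℕ → ℤ → ℤ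
    blockDifference d s = (weight w (P₂-block-numerator d s) - weight w (P₂-block-denominator d s))
                          + (weight w (P₃-block-denominator d s) - weight w (P₃-block-numerator d s))
    blockDifference≡secondDifference : ∀ d s → blockDifference d s ≡ secondDifference d s
    blockDifference≡secondDifference d s = cong₂ _+_
      (cong₂ _-_ (weight-P₂-block-numerator d s) (weight-P₂-block-denominator d s))
      (cong₂ _-_ (ℤP.+-identityʳ (w (d , s))) (ℤP.+-identityʳ (w (d , s + 1ℤ))))
    shift-on-pair : ∀ b a i e → (((1ℤ + b) - (1ℤ + a)) - (1ℤ + (1ℤ + (i + e)))) + (1ℤ + i) ≡ (b - a) - (1ℤ + e)
    shift-on-pair = ℤSolver.solve-∀

  Φ-step : ℕ → ℤ → ℤ
  Φ-step e u = Φ (suc e) u - Φ e u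

  runWeight-suc : ∀ d y → runWeight (suc d) y ≡ runWeight d y + w (suc d , y)
  runWeight-suc d y = ∑-last d _

  secondDifference-Φ-step : ∀ e u → secondDifference (suc e) (u - + suc e) ≡ Φ-step e (u - 1ℤ) - Φ-step e u
  secondDifference-Φ-step e u = begin
    ((R′ (y - 1ℤ) + R′ (y + 1ℤ)) - (R′ y + R′ y)) + (W y - W (y + 1ℤ))
      ≡⟨ cong₂ (λ p q → ((R′ (y - 1ℤ) + p) - (q + q)) + (W y - W (y + 1ℤ))) (runWeight-suc e (y + 1ℤ)) (runWeight-suc e y) ⟩
    ((R′ (y - 1ℤ) + (R (y + 1ℤ) + W (y + 1ℤ))) - ((R y + W y) + (R y + W y))) + (W y - W (y + 1ℤ))
      ≡⟨ regroup (R′ (y - 1ℤ)) (R y) (R (y + 1ℤ)) (W y) (W (y + 1ℤ)) ⟩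
    (R′ (y - 1ℤ) - R y) - ((R y + W y) - R (y + 1ℤ))
      ≡⟨ cong (λ q → (R′ (y - 1ℤ) - R y) - (q - R (y + 1ℤ))) (sym (runWeight-suc e y)) ⟩
    (R′ (y - 1ℤ) - R y) - (R′ y - R (y + 1ℤ))
      ≡⟨ cong₂ (λ p q → (R′ p - R q) - (R′ y - R (y + 1ℤ))) (shift₁ u (+ e)) (shift₂ u (+ e)) ⟩
    (R′ ((u - 1ℤ) - + suc e) - R ((u - 1ℤ) - + e)) - (R′ y - R (y + 1ℤ))
      ≡⟨ cong (λ r → (R′ ((u - 1ℤ) - + suc e) - R ((u - 1ℤ) - + e)) - (R′ y - R r)) (shift₃ u (+ e)) ⟩
    Φ-step e (u - 1ℤ) - Φ-step e u
      ∎
    where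
    R′ R W : ℤ → ℤ
    R′ = runWeight (suc e)
    R  = runWeight e
    W z = w (suc e , z)
    y = u - + suc e
    regroup : ∀ a r₀ r₊ w₀ w₊ → ((a + (r₊ + w₊)) - ((r₀ + w₀) + (r₀ + w₀))) + (w₀ - w₊) ≡ (a - r₀) - ((r₀ + w₀) - r₊)
    regroup = ℤSolver.solve-∀
    shift₁ : ∀ u e → (u - (1ℤ + e)) - 1ℤ ≡ (u - 1ℤ) - (1ℤ + e)
    shift₁ = ℤSolver.solve-∀
    shift₂ : ∀ u e → u - (1ℤ + e) ≡ (u - 1ℤ) - e
    shift₂ = ℤSolver.solve-∀
    shift₃ : ∀ u e → (u - (1ℤ + e)) + 1ℤ ≡ u - e
    shift₃ = ℤSolver.solve-∀

  ∑-secondDifference : ∀ e b P →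
    ∑[ a < P ] secondDifference (suc e) ((+ b - + a) - + suc e) ≡ Φ-step e (+ b - + P) - Φ-step e (+ b)
  ∑-secondDifference e b P = begin
    ∑[ a < P ] secondDifference (suc e) ((+ b - + a) - + suc e)
      ≡⟨ ∑-cong P (λ a → trans (secondDifference-Φ-step e (+ b - + a))
                                (cong (λ t → Φ-step e t - Φ-step e (+ b - + a)) (one-more (+ b) (+ a)))) ⟩
    ∑[ a < P ] (Φ-step e (+ b - + suc a) - Φ-step e (+ b - + a))
      ≡⟨ ∑-telescope P (λ a → Φ-step e (+ b - + a)) ⟩
    Φ-step e (+ b - + P) - Φ-step e (+ b - 0ℤ)
      ≡⟨ cong (λ t → Φ-step e (+ b - + P) - Φ-step e t) (ℤP.+-identityʳ (+ b)) ⟩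
    Φ-step e (+ b - + P) - Φ-step e (+ b)
      ∎
    where
    one-more : ∀ b a → (b - a) - 1ℤ ≡ b - (1ℤ + a)
    one-more = ℤSolver.solve-∀

  pairSum-secondDifference :
    pairSum (λ i e a b → secondDifference (suc e) ((+ b - + a) - + suc e))
      ≡ ∑[ i < L ] ∑[ e < L ∸ suc i ] ∑[ b < row (suc i ℕ.+ e) ] (Φ (suc e) (+ b - + row i) - Φ e (+ b - + row i))
        + ∑[ i < L ] ∑[ e < L ∸ suc i ] ∑[ b < row (suc i ℕ.+ e) ] (Φ e (+ b) - Φ (suc e) (+ b))
  pairSum-secondDifference =
    trans (∑-cong L λ i → trans (∑-cong (L ∸ suc i) λ e →
            trans (∑-comm (row i) (row (suc i ℕ.+ e)) _) (trans (∑-cong (row (suc i ℕ.+ e)) λ b →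
              trans (∑-secondDifference e b (row i)) (split (Φ (suc e) (+ b - + row i)) (Φ e (+ b - + row i)) (Φ (suc e) (+ b)) (Φ e (+ b))))
            (∑-distrib-+ (row (suc i ℕ.+ e)) _ _))) (∑-distrib-+ (L ∸ suc i) _ _)) (∑-distrib-+ L _ _)
    where
    split : ∀ a b c d → (a - b) - (c - d) ≡ (a - b) + (d - c)
    split = ℤSolver.solve-∀

  rows-above-telescope :
    ∑[ i < L ] ∑[ e < L ∸ suc i ] ∑[ b < row (suc i ℕ.+ e) ] (Φ e (+ b) - Φ (suc e) (+ b))
      ≡ - ∑[ j < L ] ∑[ b < row j ] Φ j (+ b)
  rows-above-telescope = begin
    ∑[ i < L ] ∑[ e < L ∸ suc i ] ∑[ b < row (suc i ℕ.+ e) ] (Φ e (+ b) - Φ (suc e) (+ b))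
      ≡⟨ ∑-cong L (λ i → ∑-cong (L ∸ suc i) λ e → sym (cong₂ (λ k l → ∑[ b < row (suc i ℕ.+ e) ] (Φ k (+ b) - Φ l (+ b)))
                                                              (ℕP.m+n∸m≡n i e) (gap i e))) ⟩
    ∑[ i < L ] ∑[ e < L ∸ suc i ] g i (suc i ℕ.+ e)
      ≡⟨ ∑-triangle L g ⟩
    ∑[ j < L ] ∑[ i < j ] g i j
      ≡⟨ ∑-cong L column ⟩
    ∑[ j < L ] (- ∑[ b < row j ] Φ j (+ b))
      ≡⟨ ∑-distrib-neg L _ ⟩
    - ∑[ j < L ] ∑[ b < row j ] Φ j (+ b)
      ∎
    where
    g : ℕ → ℕ → ℤ
    g i j = ∑[ b < row j ] (Φ (j ∸ suc i) (+ b) - Φ (j ∸ i) (+ b))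
    column : ∀ j → ∑[ i < j ] g i j ≡ - ∑[ b < row j ] Φ j (+ b)
    column j = begin
      ∑[ i < j ] g i j
        ≡⟨ ∑-comm j (row j) _ ⟩
      ∑[ b < row j ] ∑[ i < j ] (Φ (j ∸ suc i) (+ b) - Φ (j ∸ i) (+ b))
        ≡⟨ ∑-cong (row j) (λ b → ∑-congᵇ j λ i i<j →
             cong (λ k → Φ (j ∸ suc i) (+ b) - Φ k (+ b)) (ℕP.+-∸-assoc 1 i<j)) ⟩
      ∑[ b < row j ] ∑[ i < j ] (Φ (j ∸ suc i) (+ b) - Φ (suc (j ∸ suc i)) (+ b))
        ≡⟨ ∑-cong (row j) (λ b → trans (∑-reverse j (λ k → Φ k (+ b) - Φ (suc k) (+ b)))
                                     (trans (∑-telescope-down j (λ k → Φ k (+ b))) (ℤP.+-identityˡ _))) ⟩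
      ∑[ b < row j ] (- Φ j (+ b))
        ≡⟨ ∑-distrib-neg (row j) _ ⟩
      - ∑[ b < row j ] Φ j (+ b)
        ∎

  -- After exchanging the sums, the rows below row i that reach column b are the first leg(i, b + 1).
  rows-below-telescope : Antitone τ →
    ∑[ i < L ] ∑[ e < L ∸ suc i ] ∑[ b < row (suc i ℕ.+ e) ] (Φ (suc e) (+ b - + row i) - Φ e (+ b - + row i))
      ≡ ∑[ i < L ] ∑[ b < row i ] Φ (leg τ (suc i) (suc b)) (+ b - + row i)
  rows-below-telescope sorted = ∑-cong L λ i → begin
    ∑[ e < L ∸ suc i ] ∑[ b < row (suc i ℕ.+ e) ] X i e b
      ≡⟨ ∑-congᵇ (L ∸ suc i) (λ e e< → sym (∑-restrict (X i e) (λ b → b <? row (suc i ℕ.+ e))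
           (part-antitone sorted (ℕP.m≤n⇒m≤1+n (ℕP.m≤m+n i e)) (pair-in-range i e e<)) (λ _ _ → ⇔.refl))) ⟩
    ∑[ e < L ∸ suc i ] ∑[ b < row i ] (if does (b <? row (suc i ℕ.+ e)) then X i e b else 0ℤ)
      ≡⟨ ∑-comm (L ∸ suc i) (row i) _ ⟩
    ∑[ b < row i ] ∑[ e < L ∸ suc i ] (if does (b <? row (suc i ℕ.+ e)) then X i e b else 0ℤ)
      ≡⟨ ∑-cong (row i) (λ b → ∑-restrict (λ e → X i e b) (λ e → b <? row (suc i ℕ.+ e))
           (ℕP.∸-monoˡ-≤ (suc i) (conj-≤-length τ (suc b)))
           (λ e e< → ⇔.trans (≤-part⇔<-conj sorted (pair-in-range i e e<) (suc b)) (⇔.sym (<-∸⇔+-< (suc i) e _)))) ⟩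
    ∑[ b < row i ] ∑[ e < leg τ (suc i) (suc b) ] X i e b
      ≡⟨ ∑-cong (row i) (λ b → trans (∑-telescope (leg τ (suc i) (suc b)) (λ e → Φ e (+ b - + row i))) (ℤP.+-identityʳ _)) ⟩
    ∑[ b < row i ] Φ (leg τ (suc i) (suc b)) (+ b - + row i)
      ∎
    where
    X : ℕ → ℕ → ℕ → ℤ
    X i e b = Φ (suc e) (+ b - + row i) - Φ e (+ b - + row i)

  weight-balance : Antitone τ →
    weight w (P₁-factors τ) + ((weight w (P₂-numerator τ) - weight w (P₂-denominator τ))
                              + (weight w (P₃-denominator τ) - weight w (P₃-numerator τ)))
      ≡ weight w (Hs-factors τ)
  weight-balance sorted = begin
    weight w (P₁-factors τ) + ((weight w (P₂-numerator τ) - weight w (P₂-denominator τ))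
                              + (weight w (P₃-denominator τ) - weight w (P₃-numerator τ)))
      ≡⟨ cong₂ _+_ weight-P₁-factors (trans weight-P₂-P₃ pairSum-secondDifference) ⟩
    A + (below + above)
      ≡⟨ cong₂ (λ x y → A + (x + y)) (rows-below-telescope sorted) rows-above-telescope ⟩
    A + (H + - A)
      ≡⟨ cancel A H ⟩
    H
      ≡⟨ sym weight-Hs-factors ⟩
    weight w (Hs-factors τ)
      ∎
    where
    A H below above : ℤ
    A = ∑[ j < L ] ∑[ b < row j ] Φ j (+ b)
    H = ∑[ i < L ] ∑[ b < row i ] Φ (leg τ (suc i) (suc b)) (+ b - + row i)
    below = ∑[ i < L ] ∑[ e < L ∸ suc i ] ∑[ b < row (suc i ℕ.+ e) ] (Φ (suc e) (+ b - + row i) - Φ e (+ b - + row i))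
    above = ∑[ i < L ] ∑[ e < L ∸ suc i ] ∑[ b < row (suc i ℕ.+ e) ] (Φ e (+ b) - Φ (suc e) (+ b))
    cancel : ∀ a h → a + (h + - a) ≡ h
    cancel = ℤSolver.solve-∀

module _ where
  open import Data.Integer using (+_; _+_; _-_; -_)

  multiplicity-balance : ∀ τ → Antitone τ → ∀ x → multiplicity x (cleared-lhs τ) ≡ multiplicity x (cleared-rhs τ)
  multiplicity-balance τ sorted x = ℤP.+-injective (begin
    + multiplicity x (P₁-factors τ ++ (P₂-numerator τ ++ P₃-denominator τ))
      ≡⟨ sym (weight-indicator x (P₁-factors τ ++ (P₂-numerator τ ++ P₃-denominator τ))) ⟩
    weight δ (P₁-factors τ ++ (P₂-numerator τ ++ P₃-denominator τ))
      ≡⟨ trans (weight-++ δ (P₁-factors τ) _) (cong (_+_ (weight δ (P₁-factors τ))) (weight-++ δ (P₂-numerator τ) _)) ⟩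
    weight δ (P₁-factors τ) + (weight δ (P₂-numerator τ) + weight δ (P₃-denominator τ))
      ≡⟨ move (weight δ (P₁-factors τ)) (weight δ (P₂-numerator τ)) (weight δ (P₂-denominator τ))
              (weight δ (P₃-denominator τ)) (weight δ (P₃-numerator τ)) ⟩
    (weight δ (P₁-factors τ) + ((weight δ (P₂-numerator τ) - weight δ (P₂-denominator τ))
                               + (weight δ (P₃-denominator τ) - weight δ (P₃-numerator τ))))
      + (weight δ (P₂-denominator τ) + weight δ (P₃-numerator τ))
      ≡⟨ cong (_+ (weight δ (P₂-denominator τ) + weight δ (P₃-numerator τ))) (weight-balance τ δ sorted) ⟩
    weight δ (Hs-factors τ) + (weight δ (P₂-denominator τ) + weight δ (P₃-numerator τ))
      ≡⟨ sym (trans (weight-++ δ (Hs-factors τ) _) (cong (_+_ (weight δ (Hs-factors τ))) (weight-++ δ (P₂-denominator τ) _))) ⟩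
    weight δ (Hs-factors τ ++ (P₂-denominator τ ++ P₃-numerator τ))
      ≡⟨ weight-indicator x (Hs-factors τ ++ (P₂-denominator τ ++ P₃-numerator τ)) ⟩
    + multiplicity x (Hs-factors τ ++ (P₂-denominator τ ++ P₃-numerator τ))
      ∎)
    where
    δ = indicator x
    move : ∀ p n₂ d₂ d₃ n₃ → p + (n₂ + d₃) ≡ (p + ((n₂ - d₂) + (d₃ - n₃))) + (d₂ + n₃)
    move = ℤSolver.solve-∀

module _ where
  open +-*-Solver using (solve; _:*_; _:=_)

  quotient-by-cross-multiplication : ∀ {κ p₁ p₂ p₃ h A N₂ D₂ N₃ D₃ B} →
    p₁ ≡ ∏-linear κ A → IsRatio κ p₂ N₂ D₂ → IsRatio κ p₃ N₃ D₃ → h ≡ ∏-linear κ B → p₃ ≢ 0ℚ →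
    ∏-linear κ (A ++ (N₂ ++ D₃)) ≡ ∏-linear κ (B ++ (D₂ ++ N₃)) → (p₁ * p₂) * inv p₃ ≡ h
  quotient-by-cross-multiplication {κ} {p₁} {p₂} {p₃} {h} {A} {N₂} {D₂} {N₃} {D₃} {B}
    p₁≡ (p₂-cross , Y₂≢0) (p₃-cross , Y₃≢0) h≡ p₃≢0 balanced =
    *-cancelʳ-≢0 (*-≢0 p₃≢0 (*-≢0 Y₂≢0 Y₃≢0)) (begin
      ((p₁ * p₂) * inv p₃) * (p₃ * (Y₂ * Y₃))
        ≡⟨ solve 6 (λ a b c d e f → ((a :* b) :* c) :* (d :* (e :* f)) := (a :* ((b :* e) :* f)) :* (d :* c))
             refl p₁ p₂ (inv p₃) p₃ Y₂ Y₃ ⟩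
      (p₁ * ((p₂ * Y₂) * Y₃)) * (p₃ * inv p₃)
        ≡⟨ cong₂ (λ a b → (a * (b * Y₃)) * (p₃ * inv p₃)) p₁≡ p₂-cross ⟩
      (∏-linear κ A * (∏-linear κ N₂ * Y₃)) * (p₃ * inv p₃)
        ≡⟨ cong₂ _*_ cross (*-inv p₃≢0) ⟩
      (∏-linear κ B * (Y₂ * ∏-linear κ N₃)) * 1ℚ
        ≡⟨ ℚP.*-identityʳ _ ⟩
      ∏-linear κ B * (Y₂ * ∏-linear κ N₃)
        ≡⟨ cong₂ (λ a b → a * (Y₂ * b)) (sym h≡) (sym p₃-cross) ⟩
      h * (Y₂ * (p₃ * Y₃))
        ≡⟨ solve 4 (λ a b c d → a :* (b :* (c :* d)) := a :* (c :* (b :* d))) refl h Y₂ p₃ Y₃ ⟩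
      h * (p₃ * (Y₂ * Y₃))
        ∎)
    where
    Y₂ = ∏-linear κ D₂
    Y₃ = ∏-linear κ D₃
    cross : ∏-linear κ A * (∏-linear κ N₂ * Y₃) ≡ ∏-linear κ B * (Y₂ * ∏-linear κ N₃)
    cross = begin
      ∏-linear κ A * (∏-linear κ N₂ * Y₃)     ≡⟨ cong (∏-linear κ A *_) (sym (∏-linear-++ κ N₂ D₃)) ⟩
      ∏-linear κ A * ∏-linear κ (N₂ ++ D₃)    ≡⟨ sym (∏-linear-++ κ A _) ⟩
      ∏-linear κ (A ++ (N₂ ++ D₃))            ≡⟨ balanced ⟩
      ∏-linear κ (B ++ (D₂ ++ N₃))            ≡⟨ ∏-linear-++ κ B _ ⟩
      ∏-linear κ B * ∏-linear κ (D₂ ++ N₃)    ≡⟨ cong (∏-linear κ B *_) (∏-linear-++ κ D₂ N₃) ⟩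
      ∏-linear κ B * (Y₂ * ∏-linear κ N₃)     ∎

mainTheorem3 : (τ : List ℕ) → IsPartition τ → (κ : ℚ) → Admissible τ κ →
    P₃ τ κ ≢ 0ℚ → (P₁ τ κ * P₂ τ κ) * inv (P₃ τ κ) ≡ Hs τ κ
mainTheorem3 τ (_ , sorted) κ adm P₃≢0 =
  quotient-by-cross-multiplication {A = P₁-factors τ} {B = Hs-factors τ}
    (P₁-∏-linear τ κ) (P₂-IsRatio τ κ adm) (P₃-IsRatio τ κ adm) (Hs-∏-linear τ κ) P₃≢0
    (multiplicity⇒∏-linear-≡ κ (cleared-lhs τ) (cleared-rhs τ) (multiplicity-balance τ sorted))
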